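{- Let $A$ be a multigraph of con-edges satisfying Property 1 and such that $A[\alpha]$ is connected for every cluster $\alpha$. Let $e$ be a con-edge for a cluster $\alpha$ that is a bridge of $A[\alpha]$. Then every planar set $S$ of spanning trees for $A$ satisfies $e\in S$.
   Context: Setting: $C(G,T)$ is an embedded flat clustered graph: a planar graph $G$ with a fixed planar embedding whose vertex set is partitioned into clusters; $G[\alpha]$ is the subgraph induced by cluster $\alpha$. For a face $f$ of $G$, a con-edge in $f$ is a pair of occurrences, on the boundary walk of $f$, of two distinct vertices of the same cluster $\alpha$ lying in different connected components of $G[\alpha]$; it is a con-edge for $\alpha$, drawn inside $f$. Two con-edges conflict (cross) iff they lie in the same face and their occurrences alternate along its boundary; they are drawn so that they cross iff they conflict. The multigraph of con-edges is obtained by inserting all con-edges, contracting each connected component of each $G[\alpha]$ into one vertex (belonging to $\alpha$), and deleting the edges of $G$. Throughout, "a multigraph of con-edges $A$" means this multigraph or one obtained from it by a sequence of removals of con-edges and contractions (identification of the two end-vertices, possibly creating self-loops) of con-edges that cross no other con-edge; conflicts among the remaining con-edges are unchanged. $A[\alpha]$ is the sub-multigraph formed by the vertices of $\alpha$ and the con-edges for $\alpha$. A planar set of spanning trees for $A$ is a set $S$ of con-edges such that, for each cluster $\alpha$, the con-edges for $\alpha$ in $S$ form a tree spanning all vertices of $A$ in $\alpha$, and no two con-edges of $S$ conflict. The conflict graph $K_A$ has a vertex per con-edge and an edge for each conflicting pair. Property 1: no two distinct con-edges for the same cluster lie in the same connected component of $K_A$. -}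

module Defs where

open import Data.Nat using (ℕ)
open import Data.Fin using (Fin)
open import Data.Fin.Subset using (Subset; _∈_)
open import Data.List using (List; []; _∷_)
open import Data.List.Relation.Unary.Unique.Propositional using (Unique)
open import Data.Product using (Σ; ∃; ∃-syntax; _×_; _,_)
open import Data.Sum using (_⊎_)
open import Relation.Nullary using (¬_)
open import Relation.Binary.PropositionalEquality using (_≡_; _≢_)
open import Relation.Binary.Construct.Closure.ReflexiveTransitive using (Star)

-- Abstract multigraph of con-edges: vertices Fin nV, con-edges Fin nE,
-- clusters Fin nC, each vertex in one cluster, each con-edge for one
-- cluster with both end-vertices in that cluster (self-loops and
-- parallel edges allowed), plus the conflict (crossing) relation,
-- which is symmetric and irreflexive.
record ConMultigraph : Set₁ where
  field
    nV nE nC : ℕ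
    cluster  : Fin nV → Fin nC
    src tgt  : Fin nE → Fin nV
    ecl      : Fin nE → Fin nC
    src-cl   : ∀ e → cluster (src e) ≡ ecl e
    tgt-cl   : ∀ e → cluster (tgt e) ≡ ecl e
    Conflict : Fin nE → Fin nE → Set
    conflict-sym   : ∀ e f → Conflict e f → Conflict f e
    conflict-irrefl : ∀ e → ¬ Conflict e e

module _ (A : ConMultigraph) where
  open ConMultigraph A

  Joins : Fin nE → Fin nV → Fin nV → Set
  Joins e u w = (src e ≡ u × tgt e ≡ w) ⊎ (src e ≡ w × tgt e ≡ u)

  data Walk (F : Fin nE → Set) : Fin nV → Fin nV → List (Fin nE) → Set where
    nil  : ∀ {v} → Walk F v v []
    cons : ∀ {u w v es} (e : Fin nE) → F e → Joins e u w →
           Walk F w v es → Walk F u v (e ∷ es)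

  Reach : (Fin nE → Set) → Fin nV → Fin nV → Set
  Reach F u v = ∃[ es ] Walk F u v es

  HasCycle : (Fin nE → Set) → Set
  HasCycle F = ∃[ v ] ∃[ es ] (Walk F v v es × Unique es × es ≢ [])

  EdgesOf : Fin nC → Fin nE → Set
  EdgesOf α f = ecl f ≡ α

  EdgesOfMinus : Fin nC → Fin nE → Fin nE → Set
  EdgesOfMinus α e f = ecl f ≡ α × f ≢ e

  ClusterConnected : Fin nC → Set
  ClusterConnected α = ∀ u v → cluster u ≡ α → cluster v ≡ α →
                       Reach (EdgesOf α) u v

  IsBridge : Fin nC → Fin nE → Set
  IsBridge α e = ecl e ≡ α ×
    ∃[ u ] ∃[ v ] (cluster u ≡ α × cluster v ≡ α ×
                   Reach (EdgesOf α) u v × ¬ Reach (EdgesOfMinus α e) u v)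

  -- conflict graph K_A: two con-edges in the same connected component
  SameConflictComponent : Fin nE → Fin nE → Set
  SameConflictComponent = Star Conflict

  Property1 : Set
  Property1 = ∀ e f → e ≢ f → ecl e ≡ ecl f → ¬ SameConflictComponent e f

  InS : Subset nE → Fin nC → Fin nE → Set
  InS S α f = f ∈ S × ecl f ≡ α

  SpanningTreeFor : Subset nE → Fin nC → Set
  SpanningTreeFor S α =
    (∀ u v → cluster u ≡ α → cluster v ≡ α → Reach (InS S α) u v)
    × ¬ HasCycle (InS S α)

  PlanarSpanningTrees : Subset nE → Set
  PlanarSpanningTrees S =
    (∀ α → SpanningTreeFor S α) ×
    (∀ e f → e ∈ S → f ∈ S → ¬ Conflict e f)

module Submission where

-- A planar set of spanning trees S contains, for the cluster
-- α, con-edges forming a tree that spans every vertex of α; in particular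
-- any two vertices u, v of α are joined by a walk of con-edges for α lying
-- in S.  If the bridge e were missing from S, that walk would avoid e and
-- so would witness that u and v stay connected in A[α] - e, contradicting
-- the choice of u, v in the definition of a bridge.  Hence e ∈ S (membership
-- in a finite subset is decidable, so the contradiction yields e ∈ S).

open import Defs
open import Data.Fin using (Fin)
open import Data.Fin.Subset using (Subset; _∈_; _∉_)
open import Data.Fin.Subset.Properties using (_∈?_)
open import Data.Product using (_,_; proj₁)
open import Relation.Nullary using (yes; no)
open import Relation.Binary.PropositionalEquality using (_≡_; subst)
open import Data.Empty using (⊥-elim)
open ConMultigraph

module _ (A : ConMultigraph) where

  walk-mono : {F G : Fin (nE A) → Set} → (∀ {f} → F f → G f) →
              ∀ {u v es} → Walk A F u v es → Walk A G u v es
  walk-mono F⊆G nil              = nil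
  walk-mono F⊆G (cons f Ff j w) = cons f (F⊆G Ff) j (walk-mono F⊆G w)

  InS⊆EdgesOfMinus : (S : Subset (nE A)) (α : Fin (nC A)) (e : Fin (nE A)) →
                     e ∉ S → ∀ {f} → InS A S α f → EdgesOfMinus A α e f
  InS⊆EdgesOfMinus S α e e∉S (f∈S , f-for-α) =
    f-for-α , λ f≡e → e∉S (subst (_∈ S) f≡e f∈S)

  -- A bridge e of A[α] belongs to every edge set S whose con-edges for α
  -- connect all vertices of α: otherwise the endpoints separated by
  -- removing e would be connected in A[α] - e.
  bridge-in-spanning-set :
    (α : Fin (nC A)) (e : Fin (nE A)) → IsBridge A α e →
    (S : Subset (nE A)) →
    (∀ u v → cluster A u ≡ α → cluster A v ≡ α → Reach A (InS A S α) u v) →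
    e ∈ S
  bridge-in-spanning-set α e (_ , u , v , u∈α , v∈α , _ , separated) S spans
    with e ∈? S
  ... | yes e∈S = e∈S
  ... | no  e∉S =
    let (es , walk) = spans u v u∈α v∈α
    in ⊥-elim (separated (es , walk-mono (InS⊆EdgesOfMinus S α e e∉S) walk))

lemma4 : (A : ConMultigraph) → Property1 A →
         (∀ α → ClusterConnected A α) →
         (α : Fin (nC A)) (e : Fin (nE A)) → IsBridge A α e →
         (S : Subset (nE A)) → PlanarSpanningTrees A S → e ∈ S
lemma4 A _ _ α e bridge S (trees , _) =
  bridge-in-spanning-set A α e bridge S (proj₁ (trees α))
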